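{- Let $t$ be a fixed positive integer and let $\overline{\mathcal D}=(\overline X,\overline{\mathcal B},\overline\rho)$ be a $t$-$(\overline s,k,\overline\lambda_t)$-divisible design with the following properties: (i) $\overline X$ is a set of $\overline v$ points generating a finite projective space $\mathrm{PG}(d,q)$; (ii) all $\overline\rho$-transversal $t$-subsets of $\overline X$ are independent in $\mathrm{PG}(d,q)$; (iii) all blocks in $\overline{\mathcal B}$ span subspaces of $\mathrm{PG}(d,q)$ of the same dimension $\beta-1$. Then for each non-negative integer $c$ there exists a $t$-$(q^c\overline s,k,q^{c(\beta-t)}\overline\lambda_t)$-divisible design with $q^c\overline v$ points.
   Context: A $t$-$(s,k,\lambda_t)$-divisible design $(X,\mathcal B,\rho)$: $X$ finite, $\rho$ an equivalence relation (classes = point classes), a subset is $\rho$-transversal if it meets each class in at most one point; all blocks in $\mathcal B$ are $\rho$-transversal $k$-subsets of $X$, every class has size $s$, each $\rho$-transversal $t$-subset lies in exactly $\lambda_t$ blocks, and $t\le\#X/s$ (blocks are sets, no repetition). Points of $\mathrm{PG}(d,q)$ are independent if representing vectors in $\mathbb F_q^{d+1}$ are linearly independent. -}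

module Defs where

open import Level using (0ℓ)
open import Data.Nat using (ℕ; zero; suc; _≤_)
import Data.Nat as ℕ
open import Data.Fin using (Fin; zero; suc)
open import Data.Fin.Subset using (Subset; _∈_; _∉_; _⊆_; ∣_∣)
open import Data.Fin.Subset.Properties using (_⊆?_)
open import Data.Vec using (tabulate)
open import Data.List using (List; length; filter)
open import Data.List.Membership.Propositional using () renaming (_∈_ to _∈ₗ_)
open import Data.List.Relation.Unary.Unique.Propositional using (Unique)
open import Data.Product using (Σ; ∃; _×_)
open import Relation.Nullary using (¬_; does)
open import Relation.Binary using (Rel; Decidable; IsEquivalence)
open import Relation.Binary.PropositionalEquality using (_≡_)
open import Algebra.Bundles using (CommutativeRing)

classOf : ∀ {v} {ρ : Rel (Fin v) 0ℓ} → Decidable ρ → Fin v → Subset v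
classOf ρ? x = tabulate (λ y → does (ρ? x y))

Transversal : ∀ {v} → Rel (Fin v) 0ℓ → Subset v → Set
Transversal {v} ρ S = (x y : Fin v) → x ∈ S → y ∈ S → ρ x y → x ≡ y

countContaining : ∀ {v} → Subset v → List (Subset v) → ℕ
countContaining T blocks = length (filter (λ B → T ⊆? B) blocks)

record DivisibleDesign (v t s k lam : ℕ) : Set₁ where
  field
    ρ        : Rel (Fin v) 0ℓ
    ρ-equiv  : IsEquivalence ρ
    ρ?       : Decidable ρ
    classSize : ∀ x → ∣ classOf {ρ = ρ} ρ? x ∣ ≡ s
    -- t ≤ #X / s  (stated multiplicatively: s divides v here)
    t≤classes : t ℕ.* s ≤ v
    blocks   : List (Subset v)
    blocks-unique : Unique blocks
    blockSize : ∀ B → B ∈ₗ blocks → ∣ B ∣ ≡ k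
    blockTransversal : ∀ B → B ∈ₗ blocks → Transversal ρ B
    balanced : ∀ T → Transversal ρ T → ∣ T ∣ ≡ t → countContaining T blocks ≡ lam

record FiniteField (q : ℕ) : Set₁ where
  field
    commRing : CommutativeRing 0ℓ 0ℓ
  open CommutativeRing commRing public
  field
    0≉1       : ¬ (0# ≈ 1#)
    inverse   : ∀ x → ¬ (x ≈ 0#) → ∃ λ y → (x * y) ≈ 1#
    enum      : Fin q → Carrier
    enum-surj : ∀ x → ∃ λ i → x ≈ enum i
    enum-inj  : ∀ i j → enum i ≈ enum j → i ≡ j

module LinAlg {q : ℕ} (F : FiniteField q) where
  open FiniteField F using (Carrier; _≈_; _+_; _*_; 0#)

  Vec : ℕ → Set
  Vec n = Fin n → Carrier

  _≈v_ : ∀ {n} → Vec n → Vec n → Set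
  u ≈v w = ∀ j → u j ≈ w j

  Σ[_] : ∀ {m} → (Fin m → Carrier) → Carrier
  Σ[_] {zero}  f = 0#
  Σ[_] {suc m} f = f zero + Σ[ (λ i → f (suc i)) ]

  lincomb : ∀ {m n} → (Fin m → Carrier) → (Fin m → Vec n) → Vec n
  lincomb c w j = Σ[ (λ i → c i * w i j) ]

  IsZeroVec : ∀ {n} → Vec n → Set
  IsZeroVec u = ∀ j → u j ≈ 0#

  LinIndep : ∀ {m n} → (Fin m → Vec n) → Set
  LinIndep w = ∀ c → IsZeroVec (lincomb c w) → ∀ i → c i ≈ 0#

  InSpan : ∀ {m n} → (Fin m → Vec n) → Vec n → Set
  InSpan w u = ∃ λ c → u ≈v lincomb c w

  SupportedOn : ∀ {m} → Subset m → (Fin m → Carrier) → Set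
  SupportedOn S c = ∀ i → i ∉ S → c i ≈ 0#

  LinIndepOn : ∀ {m n} → (Fin m → Vec n) → Subset m → Set
  LinIndepOn w S = ∀ c → SupportedOn S c → IsZeroVec (lincomb c w) → ∀ i → i ∈ S → c i ≈ 0#

  InSpanOn : ∀ {m n} → (Fin m → Vec n) → Subset m → Vec n → Set
  InSpanOn w S u = ∃ λ c → SupportedOn S c × (u ≈v lincomb c w)

  SpanDimOn : ∀ {m n} → (Fin m → Vec n) → Subset m → ℕ → Set
  SpanDimOn {m} {n} w S β =
    Σ (Fin β → Vec n) λ b →
      LinIndep b × (∀ l → InSpanOn w S (b l)) × (∀ i → i ∈ S → InSpan b (w i))

  Spans : ∀ {m n} → (Fin m → Vec n) → Set
  Spans {m} {n} w = ∀ (u : Vec n) → InSpan w u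

  -- w represents a set of m distinct points of PG(n-1,q):
  -- nonzero vectors, pairwise non-proportional
  DistinctProjPoints : ∀ {m n} → (Fin m → Vec n) → Set
  DistinctProjPoints {m} w =
    (∀ i → ¬ IsZeroVec (w i)) ×
    (∀ (i j : Fin m) → ¬ (i ≡ j) → ¬ (∃ λ a → w i ≈v (λ l → a * w j l)))

module Submission where

open import Defs
open import Data.Nat using (ℕ; suc)
open import Data.Fin using (Fin)
open import Data.Fin.Subset using (∣_∣)
open import Relation.Binary.PropositionalEquality using (_≡_)

-- Every block B spans a β-dimensional space V_B, of which the hypothesis provides a basis.
-- The new points are the pairs (g, x) of a label g ∈ F_q^c and an old point x, encoded as
-- Fin (q ^ c * v), with (g, x) ρ'-related to (g', x') iff x ρ x'.  For each block B and each
-- c-tuple M of linear functionals on V_B the new block is the graph {(M(rep x), x) | x ∈ B};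
-- different M give different graphs since V_B is spanned by the rep x, x ∈ B.  A
-- ρ'-transversal t-set T' is the graph of some labels u over a ρ-transversal t-set T, and it
-- lies in the graph of (B, M) iff T ⊆ B and M(rep x) = u x on T.  As rep is independent on
-- T, each of the c functionals then solves an independent linear system of t equations in β
-- unknowns, which has q ^ (β ∸ t) solutions; so T' lies in q ^ (c * (β ∸ t)) * λ new blocks.

module Counting where
  open import Data.Nat using (ℕ; zero; suc; _+_; _*_)
  open import Data.Nat.Properties
  open import Algebra.Properties.CommutativeSemigroup +-commutativeSemigroup using (interchange)
  open import Data.Fin using (Fin; zero; suc; _↑ˡ_; _↑ʳ_; combine)
  import Data.Fin.Properties as FinP
  open import Data.List using (List; []; _∷_; _++_; map; concatMap; concat; length; filter; tabulate; allFin)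
  open import Data.Bool using (true; false; if_then_else_)
  open import Data.Empty using (⊥-elim)
  open import Relation.Nullary using (¬_; yes; no; does)
  open import Relation.Unary using (Decidable)
  open import Relation.Binary.PropositionalEquality
  open ≡-Reasoning

  ∑ : ∀ {A : Set} → (A → ℕ) → List A → ℕ
  ∑ f []       = 0
  ∑ f (x ∷ xs) = f x + ∑ f xs

  module _ {A : Set} where
    ∑-cong : ∀ {f g : A → ℕ} xs → (∀ x → f x ≡ g x) → ∑ f xs ≡ ∑ g xs
    ∑-cong []       f≗g = refl
    ∑-cong (x ∷ xs) f≗g = cong₂ _+_ (f≗g x) (∑-cong xs f≗g)

    ∑-++ : ∀ (f : A → ℕ) xs ys → ∑ f (xs ++ ys) ≡ ∑ f xs + ∑ f ys
    ∑-++ f []       ys = refl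
    ∑-++ f (x ∷ xs) ys = trans (cong (f x +_) (∑-++ f xs ys)) (sym (+-assoc (f x) _ _))

    ∑-+ : ∀ (f g : A → ℕ) xs → ∑ (λ x → f x + g x) xs ≡ ∑ f xs + ∑ g xs
    ∑-+ f g []       = refl
    ∑-+ f g (x ∷ xs) =
      trans (cong ((f x + g x) +_) (∑-+ f g xs)) (interchange (f x) (g x) (∑ f xs) (∑ g xs))

    ∑-const : ∀ n (xs : List A) → ∑ (λ _ → n) xs ≡ length xs * n
    ∑-const n []       = refl
    ∑-const n (x ∷ xs) = cong (n +_) (∑-const n xs)

    ∑-*ˡ : ∀ n (f : A → ℕ) xs → ∑ (λ x → n * f x) xs ≡ n * ∑ f xs
    ∑-*ˡ n f []       = sym (*-zeroʳ n)
    ∑-*ˡ n f (x ∷ xs) = trans (cong (n * f x +_) (∑-*ˡ n f xs)) (sym (*-distribˡ-+ n (f x) _))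

    ∑-zero : ∀ (f : A → ℕ) xs → (∀ x → f x ≡ 0) → ∑ f xs ≡ 0
    ∑-zero f []       f≗0 = refl
    ∑-zero f (x ∷ xs) f≗0 rewrite f≗0 x = ∑-zero f xs f≗0

  module _ {A B : Set} where
    ∑-map : ∀ (f : B → ℕ) (g : A → B) xs → ∑ f (map g xs) ≡ ∑ (λ x → f (g x)) xs
    ∑-map f g []       = refl
    ∑-map f g (x ∷ xs) = cong (f (g x) +_) (∑-map f g xs)

    ∑-concatMap : ∀ (f : B → ℕ) (g : A → List B) xs →
                  ∑ f (concatMap g xs) ≡ ∑ (λ a → ∑ f (g a)) xs
    ∑-concatMap f g []       = refl
    ∑-concatMap f g (x ∷ xs) =
      trans (∑-++ f (g x) (concat (map g xs))) (cong (∑ f (g x) +_) (∑-concatMap f g xs))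

    ∑-swap : ∀ (f : A → B → ℕ) xs ys →
             ∑ (λ a → ∑ (f a) ys) xs ≡ ∑ (λ b → ∑ (λ a → f a b) xs) ys
    ∑-swap f []       ys = sym (∑-zero _ ys (λ _ → refl))
    ∑-swap f (x ∷ xs) ys =
      trans (cong (∑ (f x) ys +_) (∑-swap f xs ys)) (sym (∑-+ (f x) _ ys))

  𝟙 : ∀ {A : Set} {P : A → Set} → Decidable P → A → ℕ
  𝟙 P? x = if does (P? x) then 1 else 0

  count : ∀ {A : Set} {P : A → Set} → Decidable P → List A → ℕ
  count P? = ∑ (𝟙 P?)

  module _ {A : Set} where
    𝟙-yes : ∀ {P : A → Set} (P? : Decidable P) x → P x → 𝟙 P? x ≡ 1
    𝟙-yes P? x p with P? x
    ... | yes _ = refl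
    ... | no ¬p = ⊥-elim (¬p p)

    𝟙-no : ∀ {P : A → Set} (P? : Decidable P) x → ¬ P x → 𝟙 P? x ≡ 0
    𝟙-no P? x ¬p with P? x
    ... | yes p = ⊥-elim (¬p p)
    ... | no _  = refl

    count-cong : ∀ {P Q : A → Set} (P? : Decidable P) (Q? : Decidable Q) xs →
                 (∀ x → P x → Q x) → (∀ x → Q x → P x) → count P? xs ≡ count Q? xs
    count-cong P? Q? xs P⇒Q Q⇒P = ∑-cong xs indicator
      where
      indicator : ∀ x → 𝟙 P? x ≡ 𝟙 Q? x
      indicator x with P? x | Q? x
      ... | yes _ | yes _ = refl
      ... | yes p | no ¬q = ⊥-elim (¬q (P⇒Q x p))
      ... | no ¬p | yes q = ⊥-elim (¬p (Q⇒P x q))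
      ... | no _  | no _  = refl

    count-none : ∀ {P : A → Set} (P? : Decidable P) xs → (∀ x → ¬ P x) → count P? xs ≡ 0
    count-none P? xs ¬P = ∑-zero _ xs (λ x → 𝟙-no P? x (¬P x))

    length-filter : ∀ {P : A → Set} (P? : Decidable P) xs → length (filter P? xs) ≡ count P? xs
    length-filter P? []       = refl
    length-filter P? (x ∷ xs) with does (P? x)
    ... | true  = cong suc (length-filter P? xs)
    ... | false = length-filter P? xs

    ∑-indicator : ∀ {P : A → Set} (P? : Decidable P) (N : ℕ) (f : A → ℕ) xs →
                  (∀ x → P x → f x ≡ N) → (∀ x → ¬ P x → f x ≡ 0) → ∑ f xs ≡ count P? xs * N
    ∑-indicator P? N f []       on off = refl
    ∑-indicator P? N f (x ∷ xs) on off with P? x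
    ... | yes p = cong₂ _+_ (on x p) (∑-indicator P? N f xs on off)
    ... | no ¬p = cong₂ _+_ (off x ¬p) (∑-indicator P? N f xs on off)

  ∑-tabulate : ∀ {A : Set} {n} (f : A → ℕ) (g : Fin n → A) →
               ∑ f (tabulate g) ≡ ∑ (λ i → f (g i)) (allFin n)
  ∑-tabulate {n = zero}  f g = refl
  ∑-tabulate {n = suc n} f g =
    cong (f (g zero) +_) (trans (∑-tabulate f (λ i → g (suc i))) (sym (∑-tabulate (λ i → f (g i)) suc)))

  ∑-allFin-suc : ∀ n (f : Fin (suc n) → ℕ) → ∑ f (allFin (suc n)) ≡ f zero + ∑ (λ i → f (suc i)) (allFin n)
  ∑-allFin-suc n f = cong (f zero +_) (∑-tabulate f suc)

  ∑-allFin-+ : ∀ a b (f : Fin (a + b) → ℕ) →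
               ∑ f (allFin (a + b)) ≡ ∑ (λ i → f (i ↑ˡ b)) (allFin a) + ∑ (λ j → f (a ↑ʳ j)) (allFin b)
  ∑-allFin-+ zero    b f = refl
  ∑-allFin-+ (suc a) b f = begin
    ∑ f (allFin (suc a + b))
      ≡⟨ ∑-allFin-suc (a + b) f ⟩
    f zero + ∑ (λ i → f (suc i)) (allFin (a + b))
      ≡⟨ cong (f zero +_) (∑-allFin-+ a b (λ i → f (suc i))) ⟩
    f zero + (∑ (λ i → f (suc (i ↑ˡ b))) (allFin a) + ∑ (λ j → f (suc a ↑ʳ j)) (allFin b))
      ≡⟨ +-assoc (f zero) _ _ ⟨
    (f zero + ∑ (λ i → f (suc (i ↑ˡ b))) (allFin a)) + ∑ (λ j → f (suc a ↑ʳ j)) (allFin b)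
      ≡⟨ cong (_+ ∑ (λ j → f (suc a ↑ʳ j)) (allFin b)) (∑-allFin-suc a (λ i → f (i ↑ˡ b))) ⟨
    ∑ (λ i → f (i ↑ˡ b)) (allFin (suc a)) + ∑ (λ j → f (suc a ↑ʳ j)) (allFin b)
      ∎

  ∑-allFin-* : ∀ m n (f : Fin (m * n) → ℕ) →
               ∑ f (allFin (m * n)) ≡ ∑ (λ i → ∑ (λ j → f (combine i j)) (allFin n)) (allFin m)
  ∑-allFin-* zero    n f = refl
  ∑-allFin-* (suc m) n f = begin
    ∑ f (allFin (n + m * n))
      ≡⟨ ∑-allFin-+ n (m * n) f ⟩
    ∑ (λ j → f (j ↑ˡ (m * n))) (allFin n) + ∑ (λ i → f (n ↑ʳ i)) (allFin (m * n))
      ≡⟨ cong (∑ (λ j → f (j ↑ˡ (m * n))) (allFin n) +_) (∑-allFin-* m n (λ i → f (n ↑ʳ i))) ⟩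
    ∑ (λ j → f (combine {suc m} zero j)) (allFin n) + ∑ (λ i → ∑ (λ j → f (combine (suc i) j)) (allFin n)) (allFin m)
      ≡⟨ ∑-allFin-suc m (λ i → ∑ (λ j → f (combine i j)) (allFin n)) ⟨
    ∑ (λ i → ∑ (λ j → f (combine i j)) (allFin n)) (allFin (suc m))
      ∎

  length-allFin : ∀ n → length (allFin n) ≡ n
  length-allFin n = Data.List.Properties.length-tabulate (λ i → i)
    where import Data.List.Properties

  count-≡ : ∀ n (z : Fin n) → count (FinP._≟ z) (allFin n) ≡ 1
  count-≡ (suc n) zero = begin
    count (FinP._≟ zero) (allFin (suc n))           ≡⟨ ∑-allFin-suc n (𝟙 (FinP._≟ zero)) ⟩
    1 + count (λ i → suc i FinP.≟ zero) (allFin n) ≡⟨ cong suc (count-none (λ i → suc i FinP.≟ zero) (allFin n) (λ i ())) ⟩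
    1                                               ∎
  count-≡ (suc n) (suc z) = begin
    count (FinP._≟ suc z) (allFin (suc n))         ≡⟨ ∑-allFin-suc n (𝟙 (FinP._≟ suc z)) ⟩
    count (λ i → suc i FinP.≟ suc z) (allFin n)    ≡⟨ count-cong (λ i → suc i FinP.≟ suc z) (FinP._≟ z) (allFin n)
                                                                  (λ i → FinP.suc-injective) (λ i → cong suc) ⟩
    count (FinP._≟ z) (allFin n)                    ≡⟨ count-≡ n z ⟩
    1                                               ∎

module Subsets where
  open Counting
  open import Data.Nat using (suc; _+_)
  open import Data.Fin using (Fin; suc)
  import Data.Fin.Properties as FinP
  open import Data.Fin.Subset using (Subset; _∈_; ∣_∣)
  open import Data.Product using (_×_; _,_)
  open import Data.Fin.Subset.Properties using (_∈?_; drop-there)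
  open import Data.Vec using ([]; _∷_; there; tabulate)
  import Data.Vec
  open import Data.Vec.Properties using (lookup∘tabulate; []=⇒lookup; lookup⇒[]=)
  open import Data.List using (allFin)
  import Data.List
  open import Data.Bool using (true; false)
  open import Data.Empty using (⊥-elim)
  open import Relation.Nullary using (¬_; Dec; yes; no; does)
  open import Relation.Nullary.Decidable using (_×-dec_; ¬?)
  open import Relation.Unary using (Decidable)
  open import Relation.Binary.PropositionalEquality
  open ≡-Reasoning

  -- membership of suc i in b ∷ p is membership of i in p
  tail-count : ∀ {n} (p : Subset (suc n)) →
               count (_∈? Data.Vec.tail p) (allFin n) ≡ ∑ (𝟙 (_∈? p)) (Data.List.tabulate suc)
  tail-count {n} (b ∷ p) = trans (count-cong (_∈? p) (λ i → suc i ∈? (b ∷ p)) (allFin n) (λ i → there) (λ i → drop-there))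
                             (sym (∑-tabulate (𝟙 (_∈? (b ∷ p))) suc))

  ∣p∣≡count : ∀ {n} (p : Subset n) → ∣ p ∣ ≡ count (_∈? p) (allFin n)
  ∣p∣≡count []                = refl
  ∣p∣≡count {suc n} (true ∷ p)  = cong suc (trans (∣p∣≡count p) (tail-count (true ∷ p)))
  ∣p∣≡count {suc n} (false ∷ p) = trans (∣p∣≡count p) (tail-count (false ∷ p))

  ⟦_⟧ : ∀ {n} {P : Fin n → Set} → Decidable P → Subset n
  ⟦ P? ⟧ = tabulate (λ i → does (P? i))

  ∈⟦⟧⇒ : ∀ {n} {P : Fin n → Set} (P? : Decidable P) x → x ∈ ⟦ P? ⟧ → P x
  ∈⟦⟧⇒ {P = P} P? x x∈ = true⇒P (P? x) (trans (sym (lookup∘tabulate (λ i → does (P? i)) x)) ([]=⇒lookup x∈))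
    where
    true⇒P : (d : Dec (P x)) → does d ≡ true → P x
    true⇒P (yes p) _ = p
    true⇒P (no _) ()

  ⇒∈⟦⟧ : ∀ {n} {P : Fin n → Set} (P? : Decidable P) x → P x → x ∈ ⟦ P? ⟧
  ⇒∈⟦⟧ {P = P} P? x p = lookup⇒[]= x _ (trans (lookup∘tabulate (λ i → does (P? i)) x) (P⇒true (P? x)))
    where
    P⇒true : (d : Dec (P x)) → does d ≡ true
    P⇒true (yes _) = refl
    P⇒true (no ¬p) = ⊥-elim (¬p p)

  ∣⟦⟧∣≡count : ∀ {n} {P : Fin n → Set} (P? : Decidable P) → ∣ ⟦ P? ⟧ ∣ ≡ count P? (allFin n)
  ∣⟦⟧∣≡count {n} P? = trans (∣p∣≡count ⟦ P? ⟧) (count-cong (_∈? ⟦ P? ⟧) P? (allFin n) (∈⟦⟧⇒ P?) (⇒∈⟦⟧ P?))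

  _without_ : ∀ {n} → Subset n → Fin n → Subset n
  S without x0 = ⟦ (λ y → (y ∈? S) ×-dec ¬? (y FinP.≟ x0)) ⟧

  ∈-without⁻ : ∀ {n} {S : Subset n} {x0 y} → y ∈ S without x0 → y ∈ S × ¬ (y ≡ x0)
  ∈-without⁻ {S = S} {x0} {y} = ∈⟦⟧⇒ (λ y → (y ∈? S) ×-dec ¬? (y FinP.≟ x0)) y

  ∈-without⁺ : ∀ {n} {S : Subset n} {x0 y} → y ∈ S → ¬ (y ≡ x0) → y ∈ S without x0
  ∈-without⁺ {S = S} {x0} {y} y∈S y≢x0 = ⇒∈⟦⟧ (λ y → (y ∈? S) ×-dec ¬? (y FinP.≟ x0)) y (y∈S , y≢x0)

  ∣S∣≡1+∣S-x0∣ : ∀ {n} (S : Subset n) x0 → x0 ∈ S → ∣ S ∣ ≡ suc ∣ S without x0 ∣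
  ∣S∣≡1+∣S-x0∣ {n} S x0 x0∈S = begin
    ∣ S ∣                            ≡⟨ ∣p∣≡count S ⟩
    ∑ (𝟙 (_∈? S)) (allFin n)        ≡⟨ ∑-cong (allFin n) split ⟩
    ∑ (λ y → 𝟙 (FinP._≟ x0) y + 𝟙 S-x0? y) (allFin n)
                                     ≡⟨ ∑-+ (𝟙 (FinP._≟ x0)) (𝟙 S-x0?) (allFin n) ⟩
    count (FinP._≟ x0) (allFin n) + count S-x0? (allFin n)
                                     ≡⟨ cong₂ _+_ (count-≡ n x0) (sym (∣⟦⟧∣≡count S-x0?)) ⟩
    suc ∣ S without x0 ∣             ∎
    where
    S-x0? : Decidable (λ y → y ∈ S × ¬ (y ≡ x0))
    S-x0? y = (y ∈? S) ×-dec ¬? (y FinP.≟ x0)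
    split : ∀ y → 𝟙 (_∈? S) y ≡ 𝟙 (FinP._≟ x0) y + 𝟙 S-x0? y
    split y with y ∈? S | y FinP.≟ x0
    ... | yes _   | yes _     = refl
    ... | yes _   | no _      = refl
    ... | no _    | no _      = refl
    ... | no y∉S  | yes refl  = ⊥-elim (y∉S x0∈S)

module Functions where
  open Counting
  open import Data.Nat using (ℕ; zero; suc; _+_; _*_; _^_)
  open import Data.Fin using (Fin; zero; suc)
  open import Data.List using (List; []; _∷_; map; concatMap)
  open import Data.List.Relation.Unary.All as All using ([])
  import Data.List.Relation.Unary.All.Properties as AllP
  open import Data.List.Relation.Unary.AllPairs as AP using (AllPairs; []; _∷_)
  import Data.List.Relation.Unary.AllPairs.Properties as APP
  open import Data.Product using (∃; _,_)
  open import Relation.Nullary using (¬_)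
  open import Relation.Unary using (Decidable)
  open import Relation.Binary.PropositionalEquality

  _∷ᶠ_ : ∀ {A : Set} {k} → A → (Fin k → A) → Fin (suc k) → A
  (a ∷ᶠ f) zero    = a
  (a ∷ᶠ f) (suc i) = f i

  functions : ∀ {A : Set} (k : ℕ) → List A → List (Fin k → A)
  functions zero    xs = (λ ()) ∷ []
  functions (suc k) xs = concatMap (λ a → map (a ∷ᶠ_) (functions k xs)) xs

  ∏ : (k : ℕ) → (Fin k → ℕ) → ℕ
  ∏ zero    g = 1
  ∏ (suc k) g = g zero * ∏ k (λ i → g (suc i))

  ∏-const : ∀ k N → ∏ k (λ _ → N) ≡ N ^ k
  ∏-const zero    N = refl
  ∏-const (suc k) N = cong (N *_) (∏-const k N)

  ∏-cong : ∀ k {f g : Fin k → ℕ} → (∀ i → f i ≡ g i) → ∏ k f ≡ ∏ k g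
  ∏-cong zero    f≗g = refl
  ∏-cong (suc k) f≗g = cong₂ _*_ (f≗g zero) (∏-cong k (λ i → f≗g (suc i)))

  count-by-head : ∀ {A : Set} {b} (xs : List A) {Q : (Fin (suc b) → A) → Set} (Q? : Decidable Q) →
                  count Q? (functions (suc b) xs) ≡ ∑ (λ a → count (λ f → Q? (a ∷ᶠ f)) (functions b xs)) xs
  count-by-head {b = b} xs Q? =
    trans (∑-concatMap (𝟙 Q?) (λ a → map (a ∷ᶠ_) (functions b xs)) xs)
          (∑-cong xs (λ a → ∑-map (𝟙 Q?) (a ∷ᶠ_) (functions b xs)))

  count-functions : ∀ {A : Set} k (xs : List A) (R : Fin k → A → Set) (R? : ∀ i → Decidable (R i))
    {Q : (Fin k → A) → Set} (Q? : Decidable Q) →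
    (∀ f → Q f → ∀ i → R i (f i)) → (∀ f → (∀ i → R i (f i)) → Q f) →
    count Q? (functions k xs) ≡ ∏ k (λ i → count (R? i) xs)
  count-functions zero xs R R? Q? Q⇒R R⇒Q = cong (_+ 0) (𝟙-yes Q? _ (R⇒Q _ (λ ())))
  count-functions (suc k) xs R R? Q? Q⇒R R⇒Q =
    trans (count-by-head xs Q?) (∑-indicator (R? zero) _ _ xs admissible-head inadmissible-head)
    where
    admissible-head : ∀ a → R zero a →
      count (λ f → Q? (a ∷ᶠ f)) (functions k xs) ≡ ∏ k (λ i → count (R? (suc i)) xs)
    admissible-head a ra =
      count-functions k xs (λ i → R (suc i)) (λ i → R? (suc i)) (λ f → Q? (a ∷ᶠ f))
        (λ f q i → Q⇒R _ q (suc i)) (λ f r → R⇒Q _ (λ { zero → ra ; (suc i) → r i }))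
    inadmissible-head : ∀ a → ¬ R zero a → count (λ f → Q? (a ∷ᶠ f)) (functions k xs) ≡ 0
    inadmissible-head a ¬ra = count-none (λ f → Q? (a ∷ᶠ f)) (functions k xs) (λ f q → ¬ra (Q⇒R _ q zero))

  functions-apart : ∀ {A : Set} {R : A → A → Set} k (xs : List A) → AllPairs R xs →
                    AllPairs (λ f g → ∃ λ i → R (f i) (g i)) (functions k xs)
  functions-apart zero    xs apart = [] ∷ []
  functions-apart {R = R} (suc k) xs apart =
    APP.concat⁺ (AllP.map⁺ (All.universal same-head xs))
                (APP.map⁺ (AP.map (λ r → AllP.map⁺ (All.universal (λ f → AllP.map⁺ (All.universal (λ f' → zero , r) _)) _)) apart))
    where
    -- extensions of one value by different tails are apart in the tails; extensions of
    -- R-related values are apart at zero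
    shift : ∀ {a f g} → (∃ λ i → R (f i) (g i)) → ∃ λ i → R ((a ∷ᶠ f) i) ((a ∷ᶠ g) i)
    shift (i , r) = suc i , r
    same-head : ∀ a → AllPairs (λ f g → ∃ λ i → R (f i) (g i)) (map (a ∷ᶠ_) (functions k xs))
    same-head a = APP.map⁺ (AP.map shift (functions-apart k xs apart))

module FieldBasics {q : ℕ} (F : FiniteField q) where
  open import Data.Nat using (ℕ; zero; suc)
  open import Data.Fin using (Fin; zero; suc)
  import Data.Fin.Properties as FinP
  open import Data.Bool using (if_then_else_)
  open import Data.Product using (proj₁; proj₂)
  open import Data.Empty using (⊥-elim)
  open import Relation.Nullary using (¬_; Dec; yes; no; does)
  import Relation.Binary.PropositionalEquality as P
  open P using (_≡_)
  open FiniteField F hiding (zero)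
  open LinAlg F
  open import Algebra.Properties.Ring ring using (-‿+-comm; -‿distribˡ-*)
  open import Algebra.Properties.Group +-group using (//-rightDividesˡ; //-rightDividesʳ; ε⁻¹≈ε)
  open import Relation.Binary.Reasoning.Setoid setoid

  ≡⇒≈ : ∀ {x y} → x ≡ y → x ≈ y
  ≡⇒≈ P.refl = refl

  decode : Carrier → Fin q
  decode x = proj₁ (enum-surj x)

  decode-spec : ∀ x → x ≈ enum (decode x)
  decode-spec x = proj₂ (enum-surj x)

  decode-cong : ∀ {x y} → x ≈ y → decode x ≡ decode y
  decode-cong {x} {y} x≈y = enum-inj _ _ (trans (sym (decode-spec x)) (trans x≈y (decode-spec y)))

  decode-enum : ∀ i → decode (enum i) ≡ i
  decode-enum i = enum-inj _ _ (sym (decode-spec (enum i)))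

  _≈?_ : ∀ x y → Dec (x ≈ y)
  x ≈? y with decode x FinP.≟ decode y
  ... | yes e  = yes (trans (decode-spec x) (trans (≡⇒≈ (P.cong enum e)) (sym (decode-spec y))))
  ... | no ¬e = no (λ x≈y → ¬e (decode-cong x≈y))

  ≈-stable : ∀ {x y} → ¬ ¬ (x ≈ y) → x ≈ y
  ≈-stable {x} {y} ¬¬x≈y with x ≈? y
  ... | yes x≈y = x≈y
  ... | no x≉y  = ⊥-elim (¬¬x≈y x≉y)

  open import Algebra.Solver.Ring.NaturalCoefficients.Default commutativeSemiring public
    using (solve; _:=_; _:+_; _:*_)

  shift⇒ : ∀ {a X Y E w} → a ≈ X - Y → a + E ≈ w → E - Y ≈ w - X
  shift⇒ {a} {X} {Y} {E} {w} a≈X-Y a+E≈w = begin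
    E - Y             ≈⟨ sym (//-rightDividesʳ X (E - Y)) ⟩
    E - Y + X - X     ≈⟨ +-congʳ (solve 3 (λ X E nY → (E :+ nY) :+ X := (X :+ nY) :+ E) refl X E (- Y)) ⟩
    (X - Y) + E - X   ≈⟨ +-congʳ (trans (+-congʳ (sym a≈X-Y)) a+E≈w) ⟩
    w - X             ∎

  shift⇐ : ∀ {a X Y E w} → a ≈ X - Y → E - Y ≈ w - X → a + E ≈ w
  shift⇐ {a} {X} {Y} {E} {w} a≈X-Y E-Y≈w-X = begin
    a + E             ≈⟨ +-congʳ a≈X-Y ⟩
    (X - Y) + E       ≈⟨ solve 3 (λ X E nY → (X :+ nY) :+ E := X :+ (E :+ nY)) refl X E (- Y) ⟩
    X + (E - Y)       ≈⟨ +-congˡ E-Y≈w-X ⟩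
    X + (w - X)       ≈⟨ +-comm X (w - X) ⟩
    w - X + X         ≈⟨ //-rightDividesˡ X w ⟩
    w                 ∎

  pivot-solve : ∀ {p ip A E w} → p * ip ≈ 1# → p * A + E ≈ w → A ≈ (w - E) * ip
  pivot-solve {p} {ip} {A} {E} {w} p*ip≈1 pA+E≈w = begin
    A                  ≈⟨ sym (*-identityʳ A) ⟩
    A * 1#             ≈⟨ *-congˡ (sym p*ip≈1) ⟩
    A * (p * ip)       ≈⟨ solve 3 (λ A p ip → A :* (p :* ip) := (p :* A) :* ip) refl A p ip ⟩
    (p * A) * ip       ≈⟨ *-congʳ (sym (//-rightDividesʳ E (p * A))) ⟩
    (p * A + E - E) * ip ≈⟨ *-congʳ (+-congʳ pA+E≈w) ⟩
    (w - E) * ip       ∎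

  pivot-sound : ∀ {p ip E w} → p * ip ≈ 1# → p * ((w - E) * ip) + E ≈ w
  pivot-sound {p} {ip} {E} {w} p*ip≈1 = begin
    p * ((w - E) * ip) + E ≈⟨ +-congʳ (solve 3 (λ p W ip → p :* (W :* ip) := W :* (p :* ip)) refl p (w - E) ip) ⟩
    (w - E) * (p * ip) + E ≈⟨ +-congʳ (trans (*-congˡ p*ip≈1) (*-identityʳ _)) ⟩
    w - E + E              ≈⟨ //-rightDividesˡ E w ⟩
    w                      ∎

  Σ-cong : ∀ {m} {f g : Fin m → Carrier} → (∀ i → f i ≈ g i) → Σ[ f ] ≈ Σ[ g ]
  Σ-cong {zero}  f≈g = refl
  Σ-cong {suc m} f≈g = +-cong (f≈g zero) (Σ-cong (λ i → f≈g (suc i)))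

  Σ-0 : ∀ {m} {f : Fin m → Carrier} → (∀ i → f i ≈ 0#) → Σ[ f ] ≈ 0#
  Σ-0 {zero}  f≈0 = refl
  Σ-0 {suc m} f≈0 = trans (+-cong (f≈0 zero) (Σ-0 (λ i → f≈0 (suc i)))) (+-identityˡ 0#)

  Σ-+ : ∀ {m} (f g : Fin m → Carrier) → Σ[ (λ i → f i + g i) ] ≈ Σ[ f ] + Σ[ g ]
  Σ-+ {zero}  f g = sym (+-identityˡ 0#)
  Σ-+ {suc m} f g = trans (+-congˡ (Σ-+ (λ i → f (suc i)) (λ i → g (suc i))))
    (solve 4 (λ a b c d → (a :+ b) :+ (c :+ d) := (a :+ c) :+ (b :+ d)) refl (f zero) (g zero) _ _)

  Σ-*ˡ : ∀ {m} a (f : Fin m → Carrier) → Σ[ (λ i → a * f i) ] ≈ a * Σ[ f ]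
  Σ-*ˡ {zero}  a f = sym (zeroʳ a)
  Σ-*ˡ {suc m} a f = trans (+-congˡ (Σ-*ˡ a (λ i → f (suc i)))) (sym (distribˡ a _ _))

  Σ-*ʳ : ∀ {m} a (f : Fin m → Carrier) → Σ[ (λ i → f i * a) ] ≈ Σ[ f ] * a
  Σ-*ʳ a f = trans (Σ-cong (λ i → *-comm (f i) a)) (trans (Σ-*ˡ a f) (*-comm a _))

  Σ-neg : ∀ {m} (f : Fin m → Carrier) → Σ[ (λ i → - f i) ] ≈ - Σ[ f ]
  Σ-neg {zero}  f = sym ε⁻¹≈ε
  Σ-neg {suc m} f = trans (+-congˡ (Σ-neg (λ i → f (suc i)))) (-‿+-comm (f zero) _)

  Σ-swap : ∀ {m n} (f : Fin m → Fin n → Carrier) →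
           Σ[ (λ i → Σ[ (λ j → f i j) ]) ] ≈ Σ[ (λ j → Σ[ (λ i → f i j) ]) ]
  Σ-swap {zero}  {n} f = sym (Σ-0 {n} (λ j → refl))
  Σ-swap {suc m}     f = trans (+-congˡ (Σ-swap (λ i → f (suc i))))
                               (sym (Σ-+ (λ j → f zero j) (λ j → Σ[ (λ i → f (suc i) j) ])))

  δ : ∀ {m} → Fin m → Carrier → Fin m → Carrier
  δ x0 a y = if does (y FinP.≟ x0) then a else 0#

  δ-self : ∀ {m} (x0 : Fin m) a → δ x0 a x0 ≈ a
  δ-self x0 a with x0 FinP.≟ x0
  ... | yes _  = refl
  ... | no x0≢x0 = ⊥-elim (x0≢x0 P.refl)

  δ-other : ∀ {m} (x0 y : Fin m) a → ¬ (y ≡ x0) → δ x0 a y ≈ 0#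
  δ-other x0 y a y≢x0 with y FinP.≟ x0
  ... | yes y≡x0 = ⊥-elim (y≢x0 y≡x0)
  ... | no _     = refl

  Σ-δ : ∀ {m} (x0 : Fin m) a (g : Fin m → Carrier) → Σ[ (λ y → δ x0 a y * g y) ] ≈ a * g x0
  Σ-δ {suc m} zero a g =
    trans (+-congˡ (Σ-0 {m} {λ i → δ zero a (suc i) * g (suc i)} (λ i → trans (*-congʳ (δ-other zero (suc i) a (λ ()))) (zeroˡ _))))
          (+-identityʳ _)
  Σ-δ {suc m} (suc x0) a g = begin
    δ (suc x0) a zero * g zero + Σ[ (λ y → δ (suc x0) a (suc y) * g (suc y)) ]
      ≈⟨ +-cong (trans (*-congʳ (δ-other (suc x0) zero a (λ ()))) (zeroˡ _)) (Σ-cong (λ y → *-congʳ (δ-suc y))) ⟩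
    0# + Σ[ (λ y → δ x0 a y * g (suc y)) ]
      ≈⟨ +-identityˡ _ ⟩
    Σ[ (λ y → δ x0 a y * g (suc y)) ]
      ≈⟨ Σ-δ x0 a (λ y → g (suc y)) ⟩
    a * g (suc x0) ∎
    where
    δ-suc : ∀ y → δ (suc x0) a (suc y) ≈ δ x0 a y
    δ-suc y with y FinP.≟ x0
    ... | yes P.refl = refl
    ... | no _       = refl

  dot : ∀ {b} → (Fin b → Carrier) → (Fin b → Carrier) → Carrier
  dot a m = Σ[ (λ l → a l * m l) ]

  dot-lin : ∀ {b} (u w m : Fin b → Carrier) r → dot (λ l → u l - r * w l) m ≈ dot u m - r * dot w m
  dot-lin u w m r = begin
    Σ[ (λ l → (u l - r * w l) * m l) ]
      ≈⟨ Σ-cong (λ l → trans (distribʳ (m l) (u l) _) (+-congˡ (trans (sym (-‿distribˡ-* _ _)) (-‿cong (*-assoc r (w l) (m l)))))) ⟩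
    Σ[ (λ l → u l * m l - r * (w l * m l)) ]
      ≈⟨ Σ-+ (λ l → u l * m l) (λ l → - (r * (w l * m l))) ⟩
    dot u m + Σ[ (λ l → - (r * (w l * m l))) ]
      ≈⟨ +-congˡ (trans (Σ-neg (λ l → r * (w l * m l))) (-‿cong (Σ-*ˡ r (λ l → w l * m l)))) ⟩
    dot u m - r * dot w m ∎

-- Rows α x ∈ F^b indexed by x ∈ S ⊆ Fin v,
-- right-hand sides w x; candidates m range over the q ^ b vectors of F^b, listed as
-- index functions Fin b → Fin q.  Induction on b: either the first column vanishes on S
-- and the first unknown is free, or a row x0 with α x0 0 ≠ 0 determines the first unknown
-- in terms of the others and is eliminated from the remaining rows.
module LinearSystems {q : ℕ} (F : FiniteField q) {v : ℕ} where
  open Counting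
  open Subsets
  open Functions
  open import Data.Nat as ℕ using (ℕ; zero; suc; _^_; _∸_; _≤_; z≤n; s≤s)
  import Data.Nat.Properties as ℕP
  open import Data.Fin using (Fin; zero; suc)
  import Data.Fin.Properties as FinP
  open import Data.Fin.Subset using (Subset; _∈_; _∉_; ∣_∣)
  open import Data.Fin.Subset.Properties using (_∈?_)
  open import Data.List using (length; allFin)
  open import Data.Product using (_×_; _,_; proj₁; proj₂)
  open import Data.Empty using (⊥-elim)
  open import Relation.Nullary using (¬_; yes; no)
  open import Relation.Nullary.Decidable using (_×-dec_; _→-dec_; ¬?)
  open import Relation.Unary using (Decidable)
  import Relation.Binary.PropositionalEquality as P
  open P using (_≡_)
  open FiniteField F hiding (zero)
  open LinAlg F
  open FieldBasics F
  open import Algebra.Properties.Ring ring using (-‿distribˡ-*; -‿distribʳ-*)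

  ev : ∀ {b} → (Fin b → Fin q) → Vec b
  ev m l = enum (m l)

  Solves : ∀ {b} → Subset v → (Fin v → Vec b) → (Fin v → Carrier) → (Fin b → Fin q) → Set
  Solves S α w m = ∀ x → x ∈ S → dot (α x) (ev m) ≈ w x

  Solves? : ∀ {b} S α w → Decidable (Solves {b} S α w)
  Solves? S α w m = FinP.all? (λ x → (x ∈? S) →-dec (dot (α x) (ev m) ≈? w x))

  #solutions : ∀ {b} → Subset v → (Fin v → Vec b) → (Fin v → Carrier) → ℕ
  #solutions {b} S α w = count (Solves? S α w) (functions b (allFin q))

  SolutionCount : ℕ → Set
  SolutionCount b = ∀ (S : Subset v) (α : Fin v → Vec b) w → LinIndepOn α S →
                    ∣ S ∣ ≤ b × #solutions S α w ≡ q ^ (b ∸ ∣ S ∣)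

  -- without columns no row is independent, so S is empty and the empty vector solves
  solutionCount-zero : SolutionCount 0
  solutionCount-zero S α w indep =
    P.subst (λ n → n ≤ 0 × #solutions S α w ≡ q ^ (0 ∸ n)) (P.sym ∣S∣≡0)
            (z≤n , P.cong (ℕ._+ 0) (𝟙-yes (Solves? S α w) (λ ()) (λ x x∈S → ⊥-elim (S-empty x x∈S))))
    where
    S-empty : ∀ x → x ∉ S
    S-empty x x∈S = 0≉1 (sym (trans (sym (δ-self x 1#)) (indep (δ x 1#) δ-supported (λ ()) x x∈S)))
      where
      δ-supported : SupportedOn S (δ x 1#)
      δ-supported y y∉S = δ-other x y 1# (λ y≡x → y∉S (P.subst (_∈ S) (P.sym y≡x) x∈S))
    ∣S∣≡0 : ∣ S ∣ ≡ 0
    ∣S∣≡0 = P.trans (∣p∣≡count S) (count-none (_∈? S) (allFin v) S-empty)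

  tails : ∀ {b} → (Fin v → Vec (suc b)) → Fin v → Vec b
  tails α x l = α x (suc l)

  module ZeroColumn {b} (IH : SolutionCount b) (S : Subset v) (α : Fin v → Vec (suc b)) (w : Fin v → Carrier)
                    (indep : LinIndepOn α S) (column0 : ∀ x → x ∈ S → α x zero ≈ 0#) where

    tails-indep : LinIndepOn (tails α) S
    tails-indep c supp sums = indep c supp (λ { zero → Σ-0 first-column ; (suc l) → sums l })
      where
      first-column : ∀ x → c x * α x zero ≈ 0#
      first-column x with x ∈? S
      ... | yes x∈S = trans (*-congˡ (column0 x x∈S)) (zeroʳ _)
      ... | no x∉S  = trans (*-congʳ (supp x x∉S)) (zeroˡ _)

    head-vanishes : ∀ x → x ∈ S → ∀ a (m : Fin b → Fin q) →
                    α x zero * enum a + dot (tails α x) (ev m) ≈ dot (tails α x) (ev m)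
    head-vanishes x x∈S a m = trans (+-congʳ (trans (*-congʳ (column0 x x∈S)) (zeroˡ _))) (+-identityˡ _)

    solutions-by-head : ∀ a → count (λ m → Solves? S α w (a ∷ᶠ m)) (functions b (allFin q)) ≡ #solutions S (tails α) w
    solutions-by-head a = count-cong (λ m → Solves? S α w (a ∷ᶠ m)) (Solves? S (tails α) w) (functions b (allFin q))
      (λ m sol x x∈S → trans (sym (head-vanishes x x∈S a m)) (sol x x∈S))
      (λ m sol x x∈S → trans (head-vanishes x x∈S a m) (sol x x∈S))

    zero-column-count : ∣ S ∣ ≤ suc b × #solutions S α w ≡ q ^ (suc b ∸ ∣ S ∣)
    zero-column-count = ℕP.m≤n⇒m≤1+n ∣S∣≤b , (begin
      #solutions S α w                                      ≡⟨ count-by-head (allFin q) (Solves? S α w) ⟩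
      ∑ (λ a → count (λ m → Solves? S α w (a ∷ᶠ m)) (functions b (allFin q))) (allFin q)
                                                            ≡⟨ ∑-cong (allFin q) solutions-by-head ⟩
      ∑ (λ _ → #solutions S (tails α) w) (allFin q)         ≡⟨ ∑-const _ (allFin q) ⟩
      length (allFin q) ℕ.* #solutions S (tails α) w        ≡⟨ P.cong₂ ℕ._*_ (length-allFin q) #tail-solutions ⟩
      q ^ suc (b ∸ ∣ S ∣)                                   ≡⟨ P.cong (q ^_) (ℕP.+-∸-assoc 1 ∣S∣≤b) ⟨
      q ^ (suc b ∸ ∣ S ∣)                                   ∎)
      where
      open P.≡-Reasoning
      ∣S∣≤b = proj₁ (IH S (tails α) w tails-indep)
      #tail-solutions = proj₂ (IH S (tails α) w tails-indep)

  -- Subtracting r x times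
  -- row x0 from every other row x clears the first column; the eliminated system on
  -- S without x0 has one row and one unknown fewer, and every one of its solutions extends
  -- uniquely to a solution of the original system.
  module Pivot {b} (IH : SolutionCount b) (S : Subset v) (α : Fin v → Vec (suc b)) (w : Fin v → Carrier)
               (indep : LinIndepOn α S) (x0 : Fin v) (x0∈S : x0 ∈ S) (pivot≉0 : ¬ (α x0 zero ≈ 0#)) where
    open import Relation.Binary.Reasoning.Setoid setoid

    pivot⁻¹ : Carrier
    pivot⁻¹ = proj₁ (inverse (α x0 zero) pivot≉0)

    pivot*pivot⁻¹≈1 : α x0 zero * pivot⁻¹ ≈ 1#
    pivot*pivot⁻¹≈1 = proj₂ (inverse (α x0 zero) pivot≉0)

    r : Fin v → Carrier
    r x = α x zero * pivot⁻¹

    S' : Subset v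
    S' = S without x0

    α' : Fin v → Vec b
    α' x l = tails α x l - r x * tails α x0 l

    w' : Fin v → Carrier
    w' x = w x - r x * w x0

    eliminated-column : ∀ (c : Fin v → Carrier) l →
      Σ[ (λ x → c x * α' x l) ] ≈ Σ[ (λ x → c x * α x (suc l)) ] - Σ[ (λ x → c x * r x) ] * α x0 (suc l)
    eliminated-column c l = begin
      Σ[ (λ x → c x * α' x l) ]
        ≈⟨ Σ-cong (λ x → trans (distribˡ (c x) _ _)
                                (+-congˡ (trans (sym (-‿distribʳ-* (c x) _)) (-‿cong (sym (*-assoc (c x) (r x) a0)))))) ⟩
      Σ[ (λ x → c x * α x (suc l) - (c x * r x) * a0) ]
        ≈⟨ Σ-+ (λ x → c x * α x (suc l)) (λ x → - ((c x * r x) * a0)) ⟩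
      Σ[ (λ x → c x * α x (suc l)) ] + Σ[ (λ x → - ((c x * r x) * a0)) ]
        ≈⟨ +-congˡ (trans (Σ-neg (λ x → (c x * r x) * a0)) (-‿cong (Σ-*ʳ a0 (λ x → c x * r x)))) ⟩
      Σ[ (λ x → c x * α x (suc l)) ] - Σ[ (λ x → c x * r x) ] * a0 ∎
      where
      a0 = α x0 (suc l)

    -- a combination c of the eliminated rows, read as a combination of the original rows
    -- in which row x0 gets the extra coefficient K = - Σ c x * r x
    module LiftedCombination (c : Fin v → Carrier) where
      K : Carrier
      K = - Σ[ (λ x → c x * r x) ]

      lifted : Fin v → Carrier
      lifted x = c x + δ x0 K x

      lifted-sum : ∀ l → Σ[ (λ x → lifted x * α x l) ] ≈ Σ[ (λ x → c x * α x l) ] + K * α x0 l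
      lifted-sum l = trans (Σ-cong (λ x → distribʳ (α x l) (c x) (δ x0 K x)))
                           (trans (Σ-+ (λ x → c x * α x l) (λ x → δ x0 K x * α x l)) (+-congˡ (Σ-δ x0 K (λ x → α x l))))

      -- K is chosen to cancel the first column
      lifted-column0 : Σ[ (λ x → lifted x * α x zero) ] ≈ 0#
      lifted-column0 = begin
        Σ[ (λ x → lifted x * α x zero) ]       ≈⟨ lifted-sum zero ⟩
        T + K * α x0 zero                      ≈⟨ +-congˡ (sym (-‿distribˡ-* _ _)) ⟩
        T - Σ[ (λ x → c x * r x) ] * α x0 zero ≈⟨ +-congˡ (-‿cong Σcr*pivot≈T) ⟩
        T - T                                  ≈⟨ -‿inverseʳ T ⟩
        0#                                     ∎
        where
        T = Σ[ (λ x → c x * α x zero) ]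
        Σcr*pivot≈T : Σ[ (λ x → c x * r x) ] * α x0 zero ≈ T
        Σcr*pivot≈T = begin
          Σ[ (λ x → c x * r x) ] * α x0 zero   ≈⟨ *-congʳ (Σ-cong (λ x → sym (*-assoc (c x) (α x zero) pivot⁻¹))) ⟩
          Σ[ (λ x → T-term x * pivot⁻¹) ] * α x0 zero ≈⟨ *-congʳ (Σ-*ʳ pivot⁻¹ T-term) ⟩
          (T * pivot⁻¹) * α x0 zero            ≈⟨ *-assoc T pivot⁻¹ (α x0 zero) ⟩
          T * (pivot⁻¹ * α x0 zero)            ≈⟨ *-congˡ (trans (*-comm _ _) pivot*pivot⁻¹≈1) ⟩
          T * 1#                               ≈⟨ *-identityʳ T ⟩
          T                                    ∎
          where
          T-term = λ x → c x * α x zero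

      lifted-column : ∀ l → Σ[ (λ x → lifted x * α x (suc l)) ] ≈ Σ[ (λ x → c x * α' x l) ]
      lifted-column l = trans (lifted-sum (suc l)) (trans (+-congˡ (sym (-‿distribˡ-* _ _))) (sym (eliminated-column c l)))

    -- so a dependence among the eliminated rows would give one among the original rows
    eliminated-indep : LinIndepOn α' S'
    eliminated-indep c supp sums y y∈S' = begin
      c y        ≈⟨ sym (+-identityʳ (c y)) ⟩
      c y + 0#   ≈⟨ +-congˡ (sym (δ-other x0 y K (proj₂ (∈-without⁻ y∈S')))) ⟩
      lifted y   ≈⟨ indep lifted lifted-supported lifted-sums y (proj₁ (∈-without⁻ y∈S')) ⟩
      0#         ∎
      where
      open LiftedCombination c
      lifted-supported : SupportedOn S lifted
      lifted-supported x x∉S =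
        trans (+-cong (supp x (λ x∈S' → x∉S (proj₁ (∈-without⁻ x∈S'))))
                      (δ-other x0 x K (λ x≡x0 → x∉S (P.subst (_∈ S) (P.sym x≡x0) x0∈S))))
              (+-identityˡ 0#)
      lifted-sums : IsZeroVec (lincomb lifted α)
      lifted-sums zero    = lifted-column0
      lifted-sums (suc l) = trans (lifted-column l) (sums l)

    E : Fin v → (Fin b → Fin q) → Carrier
    E x m = dot (tails α x) (ev m)

    head : (Fin b → Fin q) → Carrier
    head m = (w x0 - E x0 m) * pivot⁻¹

    head-term : ∀ x m → α x zero * head m ≈ r x * w x0 - r x * E x0 m
    head-term x m = begin
      α x zero * ((w x0 - E x0 m) * pivot⁻¹)
        ≈⟨ solve 3 (λ a W i → a :* (W :* i) := (a :* i) :* W) refl (α x zero) (w x0 - E x0 m) pivot⁻¹ ⟩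
      r x * (w x0 - E x0 m)                    ≈⟨ distribˡ (r x) (w x0) _ ⟩
      r x * w x0 + r x * - E x0 m              ≈⟨ +-congˡ (sym (-‿distribʳ-* (r x) _)) ⟩
      r x * w x0 - r x * E x0 m                ∎

    eliminated-row : ∀ x m → dot (α' x) (ev m) ≈ E x m - r x * E x0 m
    eliminated-row x m = dot-lin (tails α x) (tails α x0) (ev m) (r x)

    solves⇒ : ∀ a m → Solves S α w (a ∷ᶠ m) → (a ≡ decode (head m)) × Solves S' α' w' m
    solves⇒ a m sol = P.trans (P.sym (decode-enum a)) (decode-cong a≈head) , eliminated
      where
      a≈head : enum a ≈ head m
      a≈head = pivot-solve pivot*pivot⁻¹≈1 (sol x0 x0∈S)
      eliminated : Solves S' α' w' m
      eliminated y y∈S' = trans (eliminated-row y m)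
        (shift⇒ (trans (*-congˡ a≈head) (head-term y m)) (sol y (proj₁ (∈-without⁻ y∈S'))))

    index⇒head : ∀ a m → a ≡ decode (head m) → enum a ≈ head m
    index⇒head a m a≡ = trans (≡⇒≈ (P.cong enum a≡)) (sym (decode-spec _))

    solves⇐ : ∀ a m → a ≡ decode (head m) → Solves S' α' w' m → Solves S α w (a ∷ᶠ m)
    solves⇐ a m a≡ sol x x∈S with x FinP.≟ x0
    ... | yes P.refl = trans (+-congʳ (*-congˡ (index⇒head a m a≡))) (pivot-sound pivot*pivot⁻¹≈1)
    ... | no x≢x0    = shift⇐ (trans (*-congˡ (index⇒head a m a≡)) (head-term x m))
                              (trans (sym (eliminated-row x m)) (sol x (∈-without⁺ x∈S x≢x0)))

  -- counting with a pivot: each solution of the eliminated system has exactly one extension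
  pivot-count : ∀ {b} (IH : SolutionCount b) S (α : Fin v → Vec (suc b)) w (indep : LinIndepOn α S) x0 (x0∈S : x0 ∈ S)
                (pivot≉0 : ¬ (α x0 zero ≈ 0#)) → ∣ S ∣ ≤ suc b × #solutions S α w ≡ q ^ (suc b ∸ ∣ S ∣)
  pivot-count {b} IH S α w indep x0 x0∈S pivot≉0 rewrite ∣S∣≡1+∣S-x0∣ S x0 x0∈S = s≤s ∣S'∣≤b , (begin
    #solutions S α w
      ≡⟨ count-by-head (allFin q) (Solves? S α w) ⟩
    ∑ (λ a → ∑ (λ m → 𝟙 (Solves? S α w) (a ∷ᶠ m)) (functions b (allFin q))) (allFin q)
      ≡⟨ ∑-swap (λ a m → 𝟙 (Solves? S α w) (a ∷ᶠ m)) (allFin q) (functions b (allFin q)) ⟩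
    ∑ (λ m → count (λ a → Solves? S α w (a ∷ᶠ m)) (allFin q)) (functions b (allFin q))
      ≡⟨ ∑-indicator (Solves? S' α' w') 1 _ (functions b (allFin q)) unique-head no-head ⟩
    #solutions S' α' w' ℕ.* 1
      ≡⟨ ℕP.*-identityʳ _ ⟩
    #solutions S' α' w'
      ≡⟨ #eliminated-solutions ⟩
    q ^ (b ∸ ∣ S' ∣) ∎)
    where
    open Pivot IH S α w indep x0 x0∈S pivot≉0
    open P.≡-Reasoning
    ∣S'∣≤b = proj₁ (IH S' α' w' eliminated-indep)
    #eliminated-solutions = proj₂ (IH S' α' w' eliminated-indep)
    unique-head : ∀ m → Solves S' α' w' m → count (λ a → Solves? S α w (a ∷ᶠ m)) (allFin q) ≡ 1
    unique-head m sol = P.trans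
      (count-cong (λ a → Solves? S α w (a ∷ᶠ m)) (FinP._≟ decode (head m)) (allFin q)
                  (λ a s → proj₁ (solves⇒ a m s)) (λ a a≡ → solves⇐ a m a≡ sol))
      (count-≡ q (decode (head m)))
    no-head : ∀ m → ¬ Solves S' α' w' m → count (λ a → Solves? S α w (a ∷ᶠ m)) (allFin q) ≡ 0
    no-head m ¬sol = count-none (λ a → Solves? S α w (a ∷ᶠ m)) (allFin q) (λ a s → ¬sol (proj₂ (solves⇒ a m s)))

  solutionCount : ∀ b → SolutionCount b
  solutionCount zero          = solutionCount-zero
  solutionCount (suc b) S α w indep with FinP.any? (λ x → (x ∈? S) ×-dec ¬? (α x zero ≈? 0#))
  ... | yes (x0 , x0∈S , pivot≉0) = pivot-count (solutionCount b) S α w indep x0 x0∈S pivot≉0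
  ... | no no-pivot = ZeroColumn.zero-column-count (solutionCount b) S α w indep
                        (λ x x∈S → ≈-stable (λ x≉0 → no-pivot (x , x∈S , x≉0)))

-- The new points are the pairs (g, x) of a label g ∈ Fin m and
-- an old point x, encoded as combine g x ∈ Fin (m * v); two new points are ρ'-related iff
-- their old points are ρ-related.
module Lifting {v t s k lam : ℕ} (D : DivisibleDesign v t s k lam) (m : ℕ) where
  open Counting
  open Subsets
  open import Level using (0ℓ)
  open import Data.Nat using (ℕ; _+_; _*_; _≤_)
  import Data.Nat.Properties as ℕP
  open import Data.Fin using (Fin; combine; remQuot)
  import Data.Fin.Properties as FinP
  open import Data.Fin.Subset using (Subset; _∈_; _⊆_; ∣_∣)
  open import Data.Fin.Subset.Properties using (_∈?_; _⊆?_; ⊆-antisym)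
  open import Data.List using (List; []; _∷_; _++_; map; length; allFin)
  open import Data.List.Membership.Propositional using () renaming (_∈_ to _∈ₗ_)
  open import Data.List.Membership.Propositional.Properties using (∈-map⁻; ∈-++⁻)
  open import Data.List.Relation.Unary.Any using (here; there)
  open import Data.List.Relation.Unary.All as All using (All; []; _∷_)
  import Data.List.Relation.Unary.All.Properties as AllP
  open import Data.List.Relation.Unary.AllPairs as AP using (AllPairs; []; _∷_)
  import Data.List.Relation.Unary.AllPairs.Properties as APP
  open import Data.List.Relation.Unary.Unique.Propositional using (Unique)
  open import Data.Sum using (inj₁; inj₂)
  open import Data.Product using (∃; _×_; _,_; proj₁; proj₂)
  open import Relation.Nullary using (¬_; Dec; yes; no)
  open import Data.Empty using (⊥-elim)
  open import Relation.Nullary.Decidable using (_×-dec_; _→-dec_)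
  open import Relation.Unary using (Decidable)
  open import Relation.Binary using (Rel; IsEquivalence)
  open import Relation.Binary.PropositionalEquality
  open ≡-Reasoning
  open DivisibleDesign D

  N : ℕ
  N = m * v

  point : Fin N → Fin v
  point p = proj₂ (remQuot {m} v p)

  label : Fin N → Fin m
  label p = proj₁ (remQuot {m} v p)

  point-combine : ∀ (g : Fin m) (x : Fin v) → point (combine g x) ≡ x
  point-combine g x = cong proj₂ (FinP.remQuot-combine g x)

  label-combine : ∀ (g : Fin m) (x : Fin v) → label (combine g x) ≡ g
  label-combine g x = cong proj₁ (FinP.remQuot-combine g x)

  combine-split : ∀ p → combine (label p) (point p) ≡ p
  combine-split p = FinP.combine-remQuot {m} v p

  ρ' : Rel (Fin N) 0ℓ
  ρ' p p' = ρ (point p) (point p')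

  ∑-points : (f : Fin N → ℕ) → ∑ f (allFin N) ≡ ∑ (λ x → ∑ (λ g → f (combine g x)) (allFin m)) (allFin v)
  ∑-points f = trans (∑-allFin-* m v f) (∑-swap (λ g x → f (combine g x)) (allFin m) (allFin v))

  Above : Subset N → Fin v → Set
  Above P x = ∃ λ (g : Fin m) → combine g x ∈ P

  above? : ∀ P → Decidable (Above P)
  above? P x = FinP.any? (λ g → combine g x ∈? P)

  shadow : Subset N → Subset v
  shadow P = ⟦ above? P ⟧

  SingleValued : Subset N → Set
  SingleValued P = ∀ x (g g' : Fin m) → combine g x ∈ P → combine g' x ∈ P → g ≡ g'

  ∣P∣≡∣shadow∣ : ∀ P → SingleValued P → ∣ P ∣ ≡ ∣ shadow P ∣
  ∣P∣≡∣shadow∣ P single = begin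
    ∣ P ∣                                                              ≡⟨ ∣p∣≡count P ⟩
    ∑ (𝟙 (_∈? P)) (allFin N)                                           ≡⟨ ∑-points (𝟙 (_∈? P)) ⟩
    ∑ (λ x → count (λ g → combine g x ∈? P) (allFin m)) (allFin v)
                                                                       ≡⟨ ∑-indicator (above? P) 1 _ (allFin v) fibre-one fibre-none ⟩
    count (above? P) (allFin v) * 1                                    ≡⟨ ℕP.*-identityʳ _ ⟩
    count (above? P) (allFin v)                                        ≡⟨ ∣⟦⟧∣≡count (above? P) ⟨
    ∣ shadow P ∣                                                       ∎
    where
    fibre-one : ∀ x → Above P x → count (λ g → combine g x ∈? P) (allFin m) ≡ 1
    fibre-one x (g , g∈) = trans (count-cong (λ g → combine g x ∈? P) (FinP._≟ g) (allFin m)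
                                              (λ g' g'∈ → single x g' g g'∈ g∈) (λ { g' refl → g∈ }))
                                  (count-≡ m g)
    fibre-none : ∀ x → ¬ Above P x → count (λ g → combine g x ∈? P) (allFin m) ≡ 0
    fibre-none x none = count-none (λ g → combine g x ∈? P) (allFin m) (λ g g∈ → none (g , g∈))

  ∈shadow⁻ : ∀ {P x} → x ∈ shadow P → Above P x
  ∈shadow⁻ {P} {x} = ∈⟦⟧⇒ (above? P) x

  ∈shadow⁺ : ∀ {P} (g : Fin m) x → combine g x ∈ P → x ∈ shadow P
  ∈shadow⁺ {P} g x g∈ = ⇒∈⟦⟧ (above? P) x (g , g∈)

  OnGraph : Subset v → (Fin v → Fin m) → Fin N → Set
  OnGraph B h p = point p ∈ B × label p ≡ h (point p)

  onGraph? : ∀ B h → Decidable (OnGraph B h)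
  onGraph? B h p = (point p ∈? B) ×-dec (label p FinP.≟ h (point p))

  graph : Subset v → (Fin v → Fin m) → Subset N
  graph B h = ⟦ onGraph? B h ⟧

  ∈graph⁻ : ∀ B h {p} → p ∈ graph B h → OnGraph B h p
  ∈graph⁻ B h {p} = ∈⟦⟧⇒ (onGraph? B h) p

  ∈graph⁺ : ∀ {B} (h : Fin v → Fin m) x → x ∈ B → combine (h x) x ∈ graph B h
  ∈graph⁺ {B} h x x∈B = ⇒∈⟦⟧ (onGraph? B h) (combine (h x) x)
    (subst (_∈ B) (sym (point-combine (h x) x)) x∈B ,
     trans (label-combine (h x) x) (cong h (sym (point-combine (h x) x))))

  graph-label : ∀ B h (g : Fin m) x → combine g x ∈ graph B h → x ∈ B × g ≡ h x
  graph-label B h g x g∈ =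
    subst (_∈ B) (point-combine g x) (proj₁ on-graph) ,
    trans (sym (label-combine g x)) (trans (proj₂ on-graph) (cong h (point-combine g x)))
    where
    on-graph = ∈graph⁻ B h g∈

  graph-shadow : ∀ B h → shadow (graph B h) ≡ B
  graph-shadow B h = ⊆-antisym (λ {x} x∈ → proj₁ (graph-label B h (proj₁ (∈shadow⁻ x∈)) x (proj₂ (∈shadow⁻ x∈))))
                               (λ {x} x∈B → ∈shadow⁺ (h x) x (∈graph⁺ h x x∈B))

  ∣graph∣ : ∀ B h → ∣ graph B h ∣ ≡ ∣ B ∣
  ∣graph∣ B h = trans (∣P∣≡∣shadow∣ (graph B h) single) (cong ∣_∣ (graph-shadow B h))
    where
    single : SingleValued (graph B h)
    single x g g' g∈ g'∈ = trans (proj₂ (graph-label B h g x g∈)) (sym (proj₂ (graph-label B h g' x g'∈)))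

  graph-transversal : ∀ B h → Transversal ρ B → Transversal ρ' (graph B h)
  graph-transversal B h B-transversal p p' p∈ p'∈ pρp' = begin
    p                                 ≡⟨ combine-split p ⟨
    combine (label p) (point p)       ≡⟨ cong₂ combine same-label same-point ⟩
    combine (label p') (point p')     ≡⟨ combine-split p' ⟩
    p'                                ∎
    where
    same-point : point p ≡ point p'
    same-point = B-transversal _ _ (proj₁ (∈graph⁻ B h p∈)) (proj₁ (∈graph⁻ B h p'∈)) pρp'
    same-label : label p ≡ label p'
    same-label = trans (proj₂ (∈graph⁻ B h p∈)) (trans (cong h same-point) (sym (proj₂ (∈graph⁻ B h p'∈))))

  graph-injectiveˡ : ∀ B h B' h' → graph B h ≡ graph B' h' → B ≡ B'
  graph-injectiveˡ B h B' h' eq = trans (sym (graph-shadow B h)) (trans (cong shadow eq) (graph-shadow B' h'))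

  graph-injectiveʳ : ∀ B h h' → graph B h ≡ graph B h' → ∀ x → x ∈ B → h x ≡ h' x
  graph-injectiveʳ B h h' eq x x∈B = proj₂ (graph-label B h' (h x) x (subst (combine (h x) x ∈_) eq (∈graph⁺ h x x∈B)))

  Agrees : Subset v → (Fin v → Fin m) → (Fin v → Fin m) → Set
  Agrees S h u = ∀ x → x ∈ S → h x ≡ u x

  agrees? : ∀ S h u → Dec (Agrees S h u)
  agrees? S h u = FinP.all? (λ x → (x ∈? S) →-dec (h x FinP.≟ u x))

  -- Suppose every block B, together with some data i : Info B, carries labellings
  -- labelling B i M for the entries M of a list Ms of pairwise apart indices, such that apart
  -- indices give different labellings of B and, for every ρ-transversal t-subset S ⊆ B and
  -- every prescribed u, exactly μ of the labellings agree with u on S.  Then the graphs of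
  -- all these labellings are the blocks of a t-(m s, k, μ λ) divisible design.  (label₀ is
  -- any label, used for old points where none is prescribed.)
  module Construction
      (label₀ : Fin m) {Idx : Set} (_#_ : Idx → Idx → Set) (Ms : List Idx) (Ms-apart : AllPairs _#_ Ms)
      (Info : Subset v → Set) (info : ∀ B → B ∈ₗ blocks → Info B)
      (labelling : ∀ B → Info B → Idx → Fin v → Fin m)
      (labelling-apart : ∀ B i M M' → Agrees B (labelling B i M) (labelling B i M') → ¬ (M # M'))
      (μ : ℕ)
      (labelling-count : ∀ B (i : Info B) S (u : Fin v → Fin m) → Transversal ρ S → ∣ S ∣ ≡ t → S ⊆ B →
                         count (λ M → agrees? S (labelling B i M) u) Ms ≡ μ)
    where

    lifts : ∀ B → Info B → List (Subset N)
    lifts B i = map (λ M → graph B (labelling B i M)) Ms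

    build : (Bs : List (Subset v)) → All Info Bs → List (Subset N)
    build []       []       = []
    build (B ∷ Bs) (i ∷ is) = lifts B i ++ build Bs is

    ∈build⁻ : ∀ Bs is y → y ∈ₗ build Bs is → ∃ λ B → B ∈ₗ Bs × ∃ λ h → y ≡ graph B h
    ∈build⁻ (B ∷ Bs) (i ∷ is) y y∈ with ∈-++⁻ (lifts B i) {build Bs is} y∈
    ... | inj₁ y∈lifts = B , here refl , labelling B i (proj₁ (∈-map⁻ _ y∈lifts)) , proj₂ (proj₂ (∈-map⁻ _ y∈lifts))
    ... | inj₂ y∈rest with ∈build⁻ Bs is y y∈rest
    ...   | B' , B'∈ , h , y≡ = B' , there B'∈ , h , y≡

    -- distinct blocks have distinct graphs, and apart labellings of a block have distinct graphs
    build-unique : ∀ Bs is → Unique Bs → Unique (build Bs is)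
    build-unique []       []       []           = []
    build-unique (B ∷ Bs) (i ∷ is) (B∉Bs ∷ uBs) =
      APP.++⁺ lifts-unique (build-unique Bs is uBs)
              (AllP.map⁺ (All.universal (λ M → All.tabulate (λ {y} → lift∉rest M y)) Ms))
      where
      lifts-unique : Unique (lifts B i)
      lifts-unique = APP.map⁺ (AP.map (λ {M} {M'} M#M' eq →
        labelling-apart B i M M' (graph-injectiveʳ B _ _ eq) M#M') Ms-apart)
      lift∉rest : ∀ M y → y ∈ₗ build Bs is → graph B (labelling B i M) ≢ y
      lift∉rest M y y∈ eq with ∈build⁻ Bs is y y∈
      ... | B' , B'∈ , h , refl = All.lookup B∉Bs B'∈ (graph-injectiveˡ B (labelling B i M) B' h eq)

    new-blocks : List (Subset N)
    new-blocks = build blocks (All.tabulate (λ {B} → info B))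

    -- A ρ'-transversal t-set T' of new points is the graph of labels u over its shadow, a
    -- ρ-transversal t-set; it lies in graph B h iff its shadow lies in B and h agrees with u
    -- there.  So it lies in μ lifts of each block containing its shadow and in none of the others.
    module Balance (T' : Subset N) (T'-transversal : Transversal ρ' T') (∣T'∣≡t : ∣ T' ∣ ≡ t) where
      T : Subset v
      T = shadow T'

      T'-single : SingleValued T'
      T'-single x g g' g∈ g'∈ = FinP.combine-injectiveˡ g x g' x
        (T'-transversal _ _ g∈ g'∈ (subst₂ ρ (sym (point-combine g x)) (sym (point-combine g' x)) ρ-refl))
        where open IsEquivalence ρ-equiv using () renaming (refl to ρ-refl)

      T-transversal : Transversal ρ T
      T-transversal x y x∈ y∈ xρy with ∈shadow⁻ x∈ | ∈shadow⁻ y∈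
      ... | gx , gx∈ | gy , gy∈ = FinP.combine-injectiveʳ gx x gy y
        (T'-transversal _ _ gx∈ gy∈ (subst₂ ρ (sym (point-combine gx x)) (sym (point-combine gy y)) xρy))

      ∣T∣≡t : ∣ T ∣ ≡ t
      ∣T∣≡t = trans (sym (∣P∣≡∣shadow∣ T' T'-single)) ∣T'∣≡t

      -- the label of the point of T' above x (label₀ where there is none)
      u : Fin v → Fin m
      u x with above? T' x
      ... | yes (g , _) = g
      ... | no _        = label₀

      u-above : ∀ x → x ∈ T → combine (u x) x ∈ T'
      u-above x x∈T with above? T' x
      ... | yes (g , g∈) = g∈
      ... | no none      = ⊥-elim (none (∈shadow⁻ x∈T))

      ⊆graph⇒ : ∀ B h → T' ⊆ graph B h → T ⊆ B × Agrees T h u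
      ⊆graph⇒ B h T'⊆ =
        (λ {x} x∈T → proj₁ (graph-label B h (u x) x (T'⊆ (u-above x x∈T)))) ,
        (λ x x∈T → sym (proj₂ (graph-label B h (u x) x (T'⊆ (u-above x x∈T)))))

      ⊆graph⇐ : ∀ B h → T ⊆ B → Agrees T h u → T' ⊆ graph B h
      ⊆graph⇐ B h T⊆B agree {p} p∈ = ⇒∈⟦⟧ (onGraph? B h) p (T⊆B x∈T , trans label≡u (sym (agree (point p) x∈T)))
        where
        p∈' : combine (label p) (point p) ∈ T'
        p∈' = subst (_∈ T') (sym (combine-split p)) p∈
        x∈T : point p ∈ T
        x∈T = ∈shadow⁺ (label p) (point p) p∈'
        label≡u : label p ≡ u (point p)
        label≡u = T'-single (point p) (label p) (u (point p)) p∈' (u-above (point p) x∈T)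

      lifts-containing : ∀ B (i : Info B) → count (T' ⊆?_) (lifts B i) ≡ 𝟙 (T ⊆?_) B * μ
      lifts-containing B i with T ⊆? B
      ... | yes T⊆B = begin
        count (T' ⊆?_) (lifts B i)                             ≡⟨ ∑-map (𝟙 (T' ⊆?_)) _ Ms ⟩
        count (λ M → T' ⊆? graph B (labelling B i M)) Ms
          ≡⟨ count-cong (λ M → T' ⊆? graph B (labelling B i M)) (λ M → agrees? T (labelling B i M) u) Ms
                        (λ M T'⊆ → proj₂ (⊆graph⇒ B (labelling B i M) T'⊆)) (λ M → ⊆graph⇐ B (labelling B i M) T⊆B) ⟩
        count (λ M → agrees? T (labelling B i M) u) Ms          ≡⟨ labelling-count B i T u T-transversal ∣T∣≡t T⊆B ⟩
        μ                                                       ≡⟨ ℕP.+-identityʳ μ ⟨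
        μ + 0                                                   ∎
      ... | no T⊈B = trans (∑-map (𝟙 (T' ⊆?_)) _ Ms)
                           (count-none (λ M → T' ⊆? graph B (labelling B i M)) Ms
                                       (λ M T'⊆ → T⊈B (proj₁ (⊆graph⇒ B (labelling B i M) T'⊆))))

      build-containing : ∀ Bs is → count (T' ⊆?_) (build Bs is) ≡ count (T ⊆?_) Bs * μ
      build-containing []       []       = refl
      build-containing (B ∷ Bs) (i ∷ is) = begin
        count (T' ⊆?_) (lifts B i ++ build Bs is)                       ≡⟨ ∑-++ _ (lifts B i) (build Bs is) ⟩
        count (T' ⊆?_) (lifts B i) + count (T' ⊆?_) (build Bs is)      ≡⟨ cong₂ _+_ (lifts-containing B i) (build-containing Bs is) ⟩
        𝟙 (T ⊆?_) B * μ + count (T ⊆?_) Bs * μ                          ≡⟨ ℕP.*-distribʳ-+ μ (𝟙 (T ⊆?_) B) _ ⟨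
        count (T ⊆?_) (B ∷ Bs) * μ                                      ∎

      containing : countContaining T' new-blocks ≡ μ * lam
      containing = begin
        countContaining T' new-blocks                   ≡⟨ length-filter (T' ⊆?_) new-blocks ⟩
        count (T' ⊆?_) new-blocks                       ≡⟨ build-containing blocks _ ⟩
        count (T ⊆?_) blocks * μ                        ≡⟨ cong (_* μ) (sym (length-filter (T ⊆?_) blocks)) ⟩
        countContaining T blocks * μ                    ≡⟨ cong (_* μ) (balanced T T-transversal ∣T∣≡t) ⟩
        lam * μ                                         ≡⟨ ℕP.*-comm lam μ ⟩
        μ * lam                                         ∎

    -- a ρ'-class is the full fibre over a ρ-class
    ∣class'∣ : ∀ p → ∣ classOf {ρ = ρ'} (λ p p' → ρ? (point p) (point p')) p ∣ ≡ m * s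
    ∣class'∣ p = begin
      ∣ classOf {ρ = ρ'} (λ p p' → ρ? (point p) (point p')) p ∣
        ≡⟨ ∣⟦⟧∣≡count (λ p' → ρ? (point p) (point p')) ⟩
      count (λ p' → ρ? (point p) (point p')) (allFin N)
        ≡⟨ ∑-points _ ⟩
      ∑ (λ x → count (λ g → ρ? (point p) (point (combine g x))) (allFin m)) (allFin v)
        ≡⟨ ∑-cong (allFin v) whole-fibre ⟩
      ∑ (λ x → m * 𝟙 (ρ? (point p)) x) (allFin v)
        ≡⟨ ∑-*ˡ m (𝟙 (ρ? (point p))) (allFin v) ⟩
      m * count (ρ? (point p)) (allFin v)
        ≡⟨ cong (m *_) (trans (sym (∣⟦⟧∣≡count (ρ? (point p)))) (classSize (point p))) ⟩
      m * s ∎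
      where
      whole-fibre : ∀ x → count (λ g → ρ? (point p) (point (combine g x))) (allFin m) ≡ m * 𝟙 (ρ? (point p)) x
      whole-fibre x = begin
        count (λ g → ρ? (point p) (point (combine g x))) (allFin m)
          ≡⟨ count-cong (λ g → ρ? (point p) (point (combine g x))) (λ _ → ρ? (point p) x) (allFin m)
               (λ g → subst (ρ (point p)) (point-combine g x)) (λ g → subst (ρ (point p)) (sym (point-combine g x))) ⟩
        ∑ (λ _ → 𝟙 (ρ? (point p)) x) (allFin m)
          ≡⟨ ∑-const _ (allFin m) ⟩
        length (allFin m) * 𝟙 (ρ? (point p)) x
          ≡⟨ cong (_* 𝟙 (ρ? (point p)) x) (length-allFin m) ⟩
        m * 𝟙 (ρ? (point p)) x ∎

    design : DivisibleDesign N t (m * s) k (μ * lam)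
    design = record
      { ρ                = ρ'
      ; ρ-equiv          = record { refl = E.refl ; sym = E.sym ; trans = E.trans }
      ; ρ?               = λ p p' → ρ? (point p) (point p')
      ; classSize        = ∣class'∣
      ; t≤classes        = subst (_≤ m * v) (sym t*[m*s]≡m*[t*s]) (ℕP.*-monoʳ-≤ m t≤classes)
      ; blocks           = new-blocks
      ; blocks-unique    = build-unique blocks _ blocks-unique
      ; blockSize        = new-block-size
      ; blockTransversal = new-block-transversal
      ; balanced         = Balance.containing
      }
      where
      module E = IsEquivalence ρ-equiv
      t*[m*s]≡m*[t*s] : t * (m * s) ≡ m * (t * s)
      t*[m*s]≡m*[t*s] = trans (sym (ℕP.*-assoc t m s)) (trans (cong (_* s) (ℕP.*-comm t m)) (ℕP.*-assoc m t s))
      new-block-size : ∀ y → y ∈ₗ new-blocks → ∣ y ∣ ≡ k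
      new-block-size y y∈ with ∈build⁻ blocks _ y y∈
      ... | B , B∈ , h , refl = trans (∣graph∣ B h) (blockSize B B∈)
      new-block-transversal : ∀ y → y ∈ₗ new-blocks → Transversal ρ' y
      new-block-transversal y y∈ with ∈build⁻ blocks _ y y∈
      ... | B , B∈ , h , refl = graph-transversal B h (blockTransversal B B∈)

-- A block B spans a β-dimensional space with a
-- chosen basis; an index M ∈ (F^β)^c is a c-tuple of linear functionals in these
-- coordinates, and the label of x ∈ B is the tuple of their values at rep x, encoded in
-- Fin (q ^ c).
module LinearLabellings (t q d : ℕ) (F : FiniteField q) {v s k lam : ℕ} (D : DivisibleDesign v t s k lam)
    (β : ℕ) (rep : Fin v → LinAlg.Vec F (suc d))
    (transversals-indep : ∀ T → Transversal (DivisibleDesign.ρ D) T → ∣ T ∣ ≡ t → LinAlg.LinIndepOn F rep T)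
    (c : ℕ) where
  open Counting
  open Functions
  open import Data.Nat as ℕ using (ℕ; zero; suc; _^_; _∸_)
  import Data.Nat.Properties as ℕP
  open import Data.Fin using (Fin; zero; suc; funToFin; finToFun)
  import Data.Fin
  import Data.Fin.Properties as FinP
  open import Data.Fin.Subset using (Subset; _∈_; _⊆_; ∣_∣)
  open import Data.Fin.Subset.Properties using (_∈?_)
  open import Data.List using (List; allFin)
  open import Data.List.Membership.Propositional using () renaming (_∈_ to _∈ₗ_)
  open import Data.List.Relation.Unary.AllPairs using (AllPairs)
  open import Data.List.Relation.Unary.Unique.Propositional.Properties using (allFin⁺)
  open import Data.Product using (∃; _,_; proj₁; proj₂)
  open import Data.Empty using (⊥-elim)
  open import Relation.Nullary using (¬_; Dec; yes; no)
  import Relation.Binary.PropositionalEquality as P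
  open P using (_≡_)
  open FiniteField F hiding (zero)
  open LinAlg F
  open FieldBasics F
  open LinearSystems F {v}
  open DivisibleDesign D using (ρ)
  open Lifting D (q ^ c) using (Agrees; agrees?)
  open import Algebra.Properties.Group +-group using (//-rightDividesˡ)
  open import Relation.Binary.Reasoning.Setoid setoid

  Idx : Set
  Idx = Fin c → Fin β → Fin q

  _#_ : Idx → Idx → Set
  M # M' = ∃ λ j → ∃ λ l → ¬ (M j l ≡ M' j l)

  Ms : List Idx
  Ms = functions c (functions β (allFin q))

  Ms-apart : AllPairs _#_ Ms
  Ms-apart = functions-apart c _ (functions-apart β (allFin q) (allFin⁺ q))

  funToFin-cong : ∀ {c} {f f' : Fin c → Fin q} → (∀ j → f j ≡ f' j) → funToFin f ≡ funToFin f'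
  funToFin-cong {zero}  f≗f' = P.refl
  funToFin-cong {suc c} f≗f' = P.cong₂ Data.Fin.combine (f≗f' zero) (funToFin-cong (λ j → f≗f' (suc j)))

  module Coordinates (B : Subset v) (span : SpanDimOn rep B β) where
    basis : Fin β → Vec (suc d)
    basis = proj₁ span

    basis-indep : LinIndep basis
    basis-indep = proj₁ (proj₂ span)

    basis-in-span : ∀ l → InSpanOn rep B (basis l)
    basis-in-span = proj₁ (proj₂ (proj₂ span))

    rep-in-span : ∀ x → x ∈ B → InSpan basis (rep x)
    rep-in-span = proj₂ (proj₂ (proj₂ span))

    -- coordinates of rep x in the basis (zero for x ∉ B)
    coords-dec : ∀ x → Dec (x ∈ B) → Vec β
    coords-dec x (yes x∈B) = proj₁ (rep-in-span x x∈B)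
    coords-dec x (no _)    = λ _ → 0#

    coords : Fin v → Vec β
    coords x = coords-dec x (x ∈? B)

    coords-spec : ∀ x → x ∈ B → ∀ j → rep x j ≈ Σ[ (λ l → coords x l * basis l j) ]
    coords-spec x x∈B j with x ∈? B
    ... | yes x∈B' = proj₂ (rep-in-span x x∈B') j
    ... | no x∉B   = ⊥-elim (x∉B x∈B)

    expand : (e : Fin v → Carrier) → SupportedOn B e → ∀ j →
             Σ[ (λ x → e x * rep x j) ] ≈ Σ[ (λ l → Σ[ (λ x → e x * coords x l) ] * basis l j) ]
    expand e supp j = begin
      Σ[ (λ x → e x * rep x j) ]                                 ≈⟨ Σ-cong term ⟩
      Σ[ (λ x → Σ[ (λ l → (e x * coords x l) * basis l j) ]) ]  ≈⟨ Σ-swap (λ x l → (e x * coords x l) * basis l j) ⟩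
      Σ[ (λ l → Σ[ (λ x → (e x * coords x l) * basis l j) ]) ]  ≈⟨ Σ-cong (λ l → Σ-*ʳ (basis l j) (λ x → e x * coords x l)) ⟩
      Σ[ (λ l → Σ[ (λ x → e x * coords x l) ] * basis l j) ]    ∎
      where
      term : ∀ x → e x * rep x j ≈ Σ[ (λ l → (e x * coords x l) * basis l j) ]
      term x = by-membership (x ∈? B)
        where
        by-membership : Dec (x ∈ B) → e x * rep x j ≈ Σ[ (λ l → (e x * coords x l) * basis l j) ]
        by-membership (yes x∈B) = trans (*-congˡ (coords-spec x x∈B j))
                                    (trans (sym (Σ-*ˡ (e x) (λ l → coords x l * basis l j)))
                                           (Σ-cong (λ l → sym (*-assoc (e x) (coords x l) (basis l j)))))
        by-membership (no x∉B)  = trans (trans (*-congʳ (supp x x∉B)) (zeroˡ _))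
                                    (sym (Σ-0 {f = λ l → (e x * coords x l) * basis l j}
                                                   (λ l → trans (*-congʳ (trans (*-congʳ (supp x x∉B)) (zeroˡ _))) (zeroˡ _))))

    coords-indep : ∀ S → S ⊆ B → LinIndepOn rep S → LinIndepOn coords S
    coords-indep S S⊆B indep e supp sums = indep e supp zero-combination
      where
      zero-combination : IsZeroVec (lincomb e rep)
      zero-combination j = trans (expand e (λ y y∉B → supp y (λ y∈S → y∉B (S⊆B y∈S))) j)
                                 (Σ-0 (λ l → trans (*-congʳ (sums l)) (zeroˡ _)))

    basis-coeffs : Fin β → Fin v → Carrier
    basis-coeffs l = proj₁ (basis-in-span l)

    basis-coeffs-supported : ∀ l → SupportedOn B (basis-coeffs l)
    basis-coeffs-supported l = proj₁ (proj₂ (basis-in-span l))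

    basis-coords : ∀ l l' → Σ[ (λ x → basis-coeffs l x * coords x l') ] ≈ δ l 1# l'
    basis-coords l l' = begin
      γ l'                           ≈⟨ sym (//-rightDividesˡ (1# * δ l 1# l') (γ l')) ⟩
      γ l' - 1# * δ l 1# l' + 1# * δ l 1# l' ≈⟨ +-congʳ (basis-indep difference difference-zero l') ⟩
      0# + 1# * δ l 1# l'            ≈⟨ trans (+-identityˡ _) (*-identityˡ _) ⟩
      δ l 1# l'                      ∎
      where
      γ : Fin β → Carrier
      γ l' = Σ[ (λ x → basis-coeffs l x * coords x l') ]
      difference : Fin β → Carrier
      difference l' = γ l' - 1# * δ l 1# l'
      difference-zero : IsZeroVec (lincomb difference basis)
      difference-zero j = begin
        lincomb difference basis j
          ≈⟨ dot-lin γ (δ l 1#) (λ l' → basis l' j) 1# ⟩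
        dot γ (λ l' → basis l' j) - 1# * dot (δ l 1#) (λ l' → basis l' j)
          ≈⟨ +-cong (sym (trans (proj₂ (proj₂ (basis-in-span l)) j) (expand (basis-coeffs l) (basis-coeffs-supported l) j)))
                    (-‿cong (trans (*-identityˡ _) (trans (Σ-δ l 1# (λ l' → basis l' j)) (*-identityˡ _)))) ⟩
        basis l j - basis l j
          ≈⟨ -‿inverseʳ _ ⟩
        0# ∎

    -- a linear functional is determined by its values at the points of B
    recover : ∀ l (f : Vec β) → f l ≈ Σ[ (λ x → basis-coeffs l x * dot (coords x) f) ]
    recover l f = sym (begin
      Σ[ (λ x → e x * dot (coords x) f) ]
        ≈⟨ Σ-cong (λ x → trans (sym (Σ-*ˡ (e x) (λ l' → coords x l' * f l')))
                                (Σ-cong (λ l' → sym (*-assoc (e x) (coords x l') (f l'))))) ⟩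
      Σ[ (λ x → Σ[ (λ l' → (e x * coords x l') * f l') ]) ]
        ≈⟨ Σ-swap (λ x l' → (e x * coords x l') * f l') ⟩
      Σ[ (λ l' → Σ[ (λ x → (e x * coords x l') * f l') ]) ]
        ≈⟨ Σ-cong (λ l' → trans (Σ-*ʳ (f l') (λ x → e x * coords x l')) (*-congʳ (basis-coords l l'))) ⟩
      Σ[ (λ l' → δ l 1# l' * f l') ]
        ≈⟨ Σ-δ l 1# f ⟩
      1# * f l
        ≈⟨ *-identityˡ (f l) ⟩
      f l ∎)
      where
      e = basis-coeffs l

    labelling : Idx → Fin v → Fin (q ^ c)
    labelling M x = funToFin (λ j → decode (dot (coords x) (ev (M j))))

    labelling-spec : ∀ M x j → dot (coords x) (ev (M j)) ≈ enum (finToFun (labelling M x) j)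
    labelling-spec M x j = trans (decode-spec _)
      (≡⇒≈ (P.cong enum (P.sym (FinP.finToFun-funToFin (λ j → decode (dot (coords x) (ev (M j)))) j))))

    labelling-apart : ∀ M M' → Agrees B (labelling M) (labelling M') → ¬ (M # M')
    labelling-apart M M' same (j , l , M≢M') = M≢M' (enum-inj _ _ (begin
      enum (M j l)                                          ≈⟨ recover l (ev (M j)) ⟩
      Σ[ (λ x → basis-coeffs l x * dot (coords x) (ev (M j))) ]  ≈⟨ Σ-cong same-value ⟩
      Σ[ (λ x → basis-coeffs l x * dot (coords x) (ev (M' j))) ] ≈⟨ sym (recover l (ev (M' j))) ⟩
      enum (M' j l)                                         ∎))
      where
      same-value : ∀ x → basis-coeffs l x * dot (coords x) (ev (M j)) ≈ basis-coeffs l x * dot (coords x) (ev (M' j))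
      same-value x = by-membership (x ∈? B)
        where
        by-membership : Dec (x ∈ B) → basis-coeffs l x * dot (coords x) (ev (M j)) ≈ basis-coeffs l x * dot (coords x) (ev (M' j))
        by-membership (yes x∈B) = *-congˡ (trans (labelling-spec M x j)
          (trans (≡⇒≈ (P.cong (λ g → enum (finToFun g j)) (same x x∈B))) (sym (labelling-spec M' x j))))
        by-membership (no x∉B) = trans (*-congʳ (basis-coeffs-supported l x x∉B))
          (trans (zeroˡ _) (sym (trans (*-congʳ (basis-coeffs-supported l x x∉B)) (zeroˡ _))))

    -- prescribing the labels on a transversal t-set S ⊆ B imposes on each of the c functionals
    -- an independent linear system of t equations in β unknowns
    labelling-count : ∀ S (u : Fin v → Fin (q ^ c)) → Transversal ρ S → ∣ S ∣ ≡ t → S ⊆ B →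
      count (λ M → agrees? S (labelling M) u) Ms ≡ q ^ (c ℕ.* (β ∸ t))
    labelling-count S u S-transversal ∣S∣≡t S⊆B = P.trans
      (count-functions c (functions β (allFin q)) (λ j → Solves S coords (targets j)) (λ j → Solves? S coords (targets j))
                       (λ M → agrees? S (labelling M) u) agree⇒solve solve⇒agree)
      (P.trans (∏-cong c (λ j → P.trans (proj₂ (solutionCount β S coords (targets j) S-indep))
                                        (P.cong (λ n → q ^ (β ∸ n)) ∣S∣≡t)))
      (P.trans (∏-const c (q ^ (β ∸ t)))
      (P.trans (ℕP.^-*-assoc q (β ∸ t) c) (P.cong (q ^_) (ℕP.*-comm (β ∸ t) c)))))
      where
      targets : Fin c → Fin v → Carrier
      targets j x = enum (finToFun (u x) j)
      S-indep : LinIndepOn coords S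
      S-indep = coords-indep S S⊆B (transversals-indep S S-transversal ∣S∣≡t)
      agree⇒solve : ∀ M → Agrees S (labelling M) u → ∀ j → Solves S coords (targets j) (M j)
      agree⇒solve M agree j x x∈S = trans (labelling-spec M x j) (≡⇒≈ (P.cong (λ g → enum (finToFun g j)) (agree x x∈S)))
      solve⇒agree : ∀ M → (∀ j → Solves S coords (targets j) (M j)) → Agrees S (labelling M) u
      solve⇒agree M solves x x∈S = P.trans
        (funToFin-cong (λ j → P.trans (decode-cong (solves j x x∈S)) (decode-enum _)))
        (FinP.funToFin-finToFin {c} {q} (u x))

  label₀ : Fin (q ^ c)
  label₀ = funToFin {c} (λ _ → decode 0#)

  lifted-design : (∀ B → B ∈ₗ DivisibleDesign.blocks D → SpanDimOn rep B β) →
                  DivisibleDesign (q ^ c ℕ.* v) t (q ^ c ℕ.* s) k (q ^ (c ℕ.* (β ∸ t)) ℕ.* lam)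
  lifted-design blocks-span =
    Lifting.Construction.design D (q ^ c) label₀ _#_ Ms Ms-apart (λ B → SpanDimOn rep B β) blocks-span
      Coordinates.labelling Coordinates.labelling-apart (q ^ (c ℕ.* (β ∸ t))) Coordinates.labelling-count

open import Data.Nat using (_*_; _^_; _∸_; _≤_)
open import Data.List.Membership.Propositional using (_∈_)

theorem3p1 : (t : ℕ) → 1 ≤ t →
    (q d : ℕ) (F : FiniteField q) →
    (v s k lam β : ℕ) (D : DivisibleDesign v t s k lam) →
    (rep : Fin v → LinAlg.Vec F (suc d)) →
    LinAlg.DistinctProjPoints F rep →
    LinAlg.Spans F rep →
    (∀ T → Transversal (DivisibleDesign.ρ D) T → ∣ T ∣ ≡ t → LinAlg.LinIndepOn F rep T) →
    (∀ B → B ∈ DivisibleDesign.blocks D → LinAlg.SpanDimOn F rep B β) →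
    (c : ℕ) → DivisibleDesign (q ^ c * v) t (q ^ c * s) k (q ^ (c * (β ∸ t)) * lam)
theorem3p1 t _ q d F v s k lam β D rep _ _ transversals-indep blocks-span c =
  LinearLabellings.lifted-design t q d F D β rep transversals-indep c blocks-span
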